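{- For all integers $k\ge 1$ and $d\ge 1$, $\chi_{CF\text{ - }CN}(K(2k+d,k))\le d+1$.
   Context: The Kneser graph $K(n,k)$ has as vertices the $k$-element subsets of $\{1,\dots,n\}$, two being adjacent iff they are disjoint. A conflict-free closed neighborhood coloring of a graph $G$ with $m$ colors is a map $C:V(G)\to\{1,\dots,m\}$ such that for every vertex $v$ there is a color $i$ with $|N[v]\cap C^{ -1}(i)|=1$, where $N[v]=N(v)\cup\{v\}$. $\chi_{CF\text{ - }CN}(G)$ denotes the minimum such $m$. -}

module Defs where

open import Data.Nat using (ℕ; _≤_)
open import Data.Fin using (Fin)
open import Data.Fin.Subset using (Subset; ∣_∣; _∩_; ⊥)
open import Data.Product using (Σ; Σ-syntax; ∃; ∃-syntax; _×_; proj₁)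
open import Data.Sum using (_⊎_)
open import Relation.Binary.PropositionalEquality using (_≡_)

-- Vertices of the Kneser graph K(n,k): k-element subsets of an n-element set
-- (the ground set {1..n} is represented by Fin n).
KVertex : ℕ → ℕ → Set
KVertex n k = Σ (Subset n) (λ s → ∣ s ∣ ≡ k)

KAdj : ∀ {n k} → KVertex n k → KVertex n k → Set
KAdj u v = (proj₁ u ∩ proj₁ v) ≡ ⊥

InClosedNbhd : ∀ {n k} → KVertex n k → KVertex n k → Set
InClosedNbhd u v = (proj₁ u ≡ proj₁ v) ⊎ KAdj v u

IsCFCNColoring : ∀ {n k} (m : ℕ) → (KVertex n k → Fin m) → Set
IsCFCNColoring {n} {k} m C =
  ∀ (v : KVertex n k) → ∃[ i ] ∃[ u ]
    ( InClosedNbhd u v × C u ≡ i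
    × (∀ (w : KVertex n k) → InClosedNbhd w v → C w ≡ i → proj₁ w ≡ proj₁ u))

χCFCN-K≤ : ℕ → ℕ → ℕ → Set
χCFCN-K≤ n k m = ∃[ m' ] (m' ≤ m × Σ (KVertex n k → Fin m') (IsCFCNColoring m'))

module Submission where

-- Write d = D+1, K = k, n = 2K+d, and colour a K-set s by the band of its
-- least element a = least s (positions counted from 0):
--   a < D  ↦ colour a,     a ∈ {D, D+1} ↦ colour D,     a ≥ D+2 ↦ colour D+1.
-- Every vertex s then has a colour occurring once in N[s]:
--   * a < D: disjoint sets have different least elements, so s is alone;
--   * a ≥ D+2: two disjoint K-sets do not fit into the n-(D+2) = 2K-1 points
--     above D+1, so again s is alone;
--   * a ∈ {D, D+1} and both D, D+1 ∈ s: a neighbour of colour D would have its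
--     least element in {D, D+1} ⊆ s, so s is alone;
--   * a ∈ {D, D+1} and exactly one of D, D+1 in s: the set of all points above
--     D+1 outside s has exactly K elements; it is the unique neighbour of s
--     whose least element is ≥ D+2, i.e. of colour D+1.
-- The file first develops subsets of Fin n viewed through ℕ-indexed positions
-- (least element, counting below a position, the free points above a
-- position), then the banded colouring, then two ways of exhibiting a
-- conflict-free witness, and finally assembles the colouring.

open import Defs
open import Data.Nat
  using (ℕ; zero; suc; pred; _+_; _*_; _∸_; _≤_; _<_; _≥_; z≤n; s≤s)
open import Data.Nat.Properties
  using ( ≡-irrelevant; ≤-refl; ≤-trans; ≤-reflexive; n≤1+n; 1+n≰n
        ; +-assoc; +-comm; +-identityʳ; +-cancelˡ-≡; +-cancelʳ-≡
        ; +-monoˡ-≤; +-monoʳ-≤; m+[n∸m]≡n; module ≤-Reasoning )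
open import Data.Nat.Tactic.RingSolver using (solve-∀)
open import Data.Bool using (Bool; true; false)
open import Data.Bool.Properties using (∧-zeroʳ)
open import Data.Fin using (Fin)
import Data.Fin as Fin
import Data.Fin.Properties as Fin
open import Data.Fin.Subset using (Subset; ∣_∣; _∩_; ⊥; ∁; _⊆_; _∈_)
open import Data.Fin.Subset.Properties
  using ( ∣p∣≤n; ∣∁p∣≡n∸∣p∣; ∩-inverseʳ; ∉⊥; x∈p∩q⁺; x∉p⇒x∈∁p
        ; out⊆; drop-∷-⊆; p⊆q⇒∣p∣≤∣q∣; ⊆-refl )
open import Data.Vec using ([]; _∷_; head; tail; here)
open import Data.Product using (∃-syntax; _×_; proj₁; proj₂; _,_)
open import Data.Sum using (_⊎_; inj₁; inj₂)
import Data.Sum as Sum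
open import Data.Empty using (⊥-elim) renaming (⊥ to Empty)
open import Relation.Binary.PropositionalEquality
  using (_≡_; _≢_; refl; sym; trans; cong; cong₂; subst; module ≡-Reasoning)

-- Subsets of Fin n seen through ℕ-indexed positions

bit : Bool → ℕ
bit true  = 1
bit false = 0

size-∷ : ∀ {n} x (s : Subset n) → ∣ x ∷ s ∣ ≡ bit x + ∣ s ∣
size-∷ true  s = refl
size-∷ false s = refl

-- Membership of the position j (never true beyond the end).
contains : ∀ {n} → Subset n → ℕ → Bool
contains []      _       = false
contains (x ∷ s) zero    = x
contains (x ∷ s) (suc j) = contains s j

-- Position of the least element of s (n when s is empty).
least : ∀ {n} → Subset n → ℕ
least []          = 0
least (true ∷ s)  = 0
least (false ∷ s) = suc (least s)

least-contained : ∀ {n} (s : Subset n) → 1 ≤ ∣ s ∣ → contains s (least s) ≡ true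
least-contained (true ∷ s)  _  = refl
least-contained (false ∷ s) ne = least-contained s ne

disjoint⇒¬shared : ∀ {n} (s t : Subset n) j → s ∩ t ≡ ⊥ →
                   contains s j ≡ true → contains t j ≡ true → Empty
disjoint⇒¬shared (x ∷ s) (y ∷ t) zero    d refl refl with cong head d
... | ()
disjoint⇒¬shared (x ∷ s) (y ∷ t) (suc j) d inS inT =
  disjoint⇒¬shared s t j (cong tail d) inS inT

disjoint⇒least≢ : ∀ {n} (s t : Subset n) → s ∩ t ≡ ⊥ → 1 ≤ ∣ s ∣ → 1 ≤ ∣ t ∣ →
                  least s ≢ least t
disjoint⇒least≢ s t d ns nt same =
  disjoint⇒¬shared s t (least t) d
    (subst (λ j → contains s j ≡ true) same (least-contained s ns))
    (least-contained t nt)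

countBelow : ∀ {n} → ℕ → Subset n → ℕ
countBelow zero    _       = 0
countBelow (suc j) []      = 0
countBelow (suc j) (x ∷ s) = bit x + countBelow j s

countBelow-suc : ∀ {n} j (s : Subset n) →
                 countBelow (suc j) s ≡ countBelow j s + bit (contains s j)
countBelow-suc zero    []      = refl
countBelow-suc zero    (x ∷ s) = +-identityʳ (bit x)
countBelow-suc (suc j) []      = refl
countBelow-suc (suc j) (x ∷ s) =
  trans (cong (bit x +_) (countBelow-suc j s)) (sym (+-assoc (bit x) _ _))

countBelow-least : ∀ {n} j (s : Subset n) → j ≤ least s → countBelow j s ≡ 0
countBelow-least zero    s           _        = refl
countBelow-least (suc j) []          _        = refl
countBelow-least (suc j) (false ∷ s) (s≤s le) = countBelow-least j s le

countBelow-window : ∀ {n} j (s : Subset n) → j ≤ least s →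
  countBelow (suc (suc j)) s ≡ bit (contains s j) + bit (contains s (suc j))
countBelow-window j s le = begin
  countBelow (suc (suc j)) s
    ≡⟨ countBelow-suc (suc j) s ⟩
  countBelow (suc j) s + bit (contains s (suc j))
    ≡⟨ cong (_+ bit (contains s (suc j))) (countBelow-suc j s) ⟩
  countBelow j s + bit (contains s j) + bit (contains s (suc j))
    ≡⟨ cong (λ c → c + bit (contains s j) + bit (contains s (suc j)))
            (countBelow-least j s le) ⟩
  bit (contains s j) + bit (contains s (suc j)) ∎
  where open ≡-Reasoning

freeAbove : ∀ {n} → ℕ → Subset n → Subset n
freeAbove zero    s       = ∁ s
freeAbove (suc j) []      = []
freeAbove (suc j) (x ∷ s) = false ∷ freeAbove j s

freeAbove-disjoint : ∀ {n} j (s : Subset n) → s ∩ freeAbove j s ≡ ⊥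
freeAbove-disjoint zero    s       = ∩-inverseʳ s
freeAbove-disjoint (suc j) []      = refl
freeAbove-disjoint (suc j) (x ∷ s) =
  cong₂ _∷_ (∧-zeroʳ x) (freeAbove-disjoint j s)

freeAbove-least : ∀ {n} j (s : Subset n) → j ≤ n → j ≤ least (freeAbove j s)
freeAbove-least zero    s       _        = z≤n
freeAbove-least (suc j) (x ∷ s) (s≤s le) = s≤s (freeAbove-least j s le)

-- Counting identity: s, its free points above j and the j positions below j
-- cover the ground set, with the part of s below j counted twice.
freeAbove-size : ∀ {n} j (s : Subset n) → j ≤ n →
                 ∣ s ∣ + ∣ freeAbove j s ∣ + j ≡ n + countBelow j s
freeAbove-size {n} zero s _ = begin
  ∣ s ∣ + ∣ ∁ s ∣ + 0   ≡⟨ +-identityʳ _ ⟩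
  ∣ s ∣ + ∣ ∁ s ∣       ≡⟨ cong (∣ s ∣ +_) (∣∁p∣≡n∸∣p∣ s) ⟩
  ∣ s ∣ + (n ∸ ∣ s ∣) ≡⟨ m+[n∸m]≡n (∣p∣≤n s) ⟩
  n                     ≡⟨ +-identityʳ n ⟨
  n + 0                 ∎
  where open ≡-Reasoning
freeAbove-size {suc n} (suc j) (x ∷ s) (s≤s le) = begin
  ∣ x ∷ s ∣ + ∣ freeAbove j s ∣ + suc j
    ≡⟨ cong (λ c → c + ∣ freeAbove j s ∣ + suc j) (size-∷ x s) ⟩
  bit x + ∣ s ∣ + ∣ freeAbove j s ∣ + suc j
    ≡⟨ regroupˡ (bit x) ∣ s ∣ ∣ freeAbove j s ∣ j ⟩
  suc (bit x + (∣ s ∣ + ∣ freeAbove j s ∣ + j))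
    ≡⟨ cong (λ c → suc (bit x + c)) (freeAbove-size j s le) ⟩
  suc (bit x + (n + countBelow j s))
    ≡⟨ regroupʳ (bit x) n (countBelow j s) ⟩
  suc n + (bit x + countBelow j s) ∎
  where
  open ≡-Reasoning
  regroupˡ : ∀ b a c i → b + a + c + suc i ≡ suc (b + (a + c + i))
  regroupˡ = solve-∀
  regroupʳ : ∀ b m c → suc (b + (m + c)) ≡ suc m + (b + c)
  regroupʳ = solve-∀

freeAbove-⊆ : ∀ {n} j (s t : Subset n) → j ≤ least t → s ∩ t ≡ ⊥ → t ⊆ freeAbove j s
freeAbove-⊆ zero s t _ d {x} x∈t =
  x∉p⇒x∈∁p (λ x∈s → ∉⊥ (subst (x ∈_) d (x∈p∩q⁺ (x∈s , x∈t))))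
freeAbove-⊆ (suc j) []      []          _        _ = ⊆-refl
freeAbove-⊆ (suc j) (x ∷ s) (false ∷ t) (s≤s le) d =
  out⊆ (freeAbove-⊆ j s t le (cong tail d))

⊆-by-size : ∀ {n} (p q : Subset n) → p ⊆ q → ∣ q ∣ ≤ ∣ p ∣ → p ≡ q
⊆-by-size []          []          _   _        = refl
⊆-by-size (true ∷ p)  (true ∷ q)  sub (s≤s le) =
  cong (true ∷_) (⊆-by-size p q (drop-∷-⊆ sub) le)
⊆-by-size (true ∷ p)  (false ∷ q) sub _ with sub here
... | ()
⊆-by-size (false ∷ p) (true ∷ q)  sub le =
  ⊥-elim (1+n≰n (≤-trans le (p⊆q⇒∣p∣≤∣q∣ (drop-∷-⊆ sub))))
⊆-by-size (false ∷ p) (false ∷ q) sub le =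
  cong (false ∷_) (⊆-by-size p q (drop-∷-⊆ sub) le)

disjoint-above-size : ∀ {n} j (s t : Subset n) → j ≤ n → j ≤ least s → j ≤ least t →
                      s ∩ t ≡ ⊥ → ∣ s ∣ + ∣ t ∣ + j ≤ n
disjoint-above-size {n} j s t j≤n js jt d = begin
  ∣ s ∣ + ∣ t ∣ + j
    ≤⟨ +-monoˡ-≤ j (+-monoʳ-≤ ∣ s ∣ (p⊆q⇒∣p∣≤∣q∣ (freeAbove-⊆ j s t jt d))) ⟩
  ∣ s ∣ + ∣ freeAbove j s ∣ + j  ≡⟨ freeAbove-size j s j≤n ⟩
  n + countBelow j s            ≡⟨ cong (n +_) (countBelow-least j s js) ⟩
  n + 0                         ≡⟨ +-identityʳ n ⟩
  n                             ∎
  where open ≤-Reasoning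

freeAbove-unique : ∀ {n} j (s t : Subset n) → j ≤ least t → s ∩ t ≡ ⊥ →
                   ∣ freeAbove j s ∣ ≤ ∣ t ∣ → t ≡ freeAbove j s
freeAbove-unique j s t jt d = ⊆-by-size t (freeAbove j s) (freeAbove-⊆ j s t jt d)

-- Colours as bands of the least element

band : (D : ℕ) → ℕ → Fin (suc (suc D))
band zero    zero          = Fin.zero
band zero    (suc zero)    = Fin.zero
band zero    (suc (suc a)) = Fin.suc Fin.zero
band (suc D) zero          = Fin.zero
band (suc D) (suc a)       = Fin.suc (band D a)

Middle : ℕ → ℕ → Set
Middle D a = a ≡ D ⊎ a ≡ suc D

middle-suc : ∀ {D a} → Middle D a → Middle (suc D) (suc a)
middle-suc = Sum.map (cong suc) (cong suc)

middle-pred : ∀ {D a} → Middle (suc D) (suc a) → Middle D a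
middle-pred = Sum.map (cong pred) (cong pred)

middle⇒≥ : ∀ {D a} → Middle D a → D ≤ a
middle⇒≥ (inj₁ refl) = ≤-refl
middle⇒≥ {D} (inj₂ refl) = n≤1+n D

middle⇒¬above : ∀ {D a} → Middle D a → suc (suc D) ≤ a → Empty
middle⇒¬above {D} (inj₁ refl) le = 1+n≰n (≤-trans (n≤1+n (suc D)) le)
middle⇒¬above     (inj₂ refl) le = 1+n≰n le

data Position (D a : ℕ) : Set where
  below  : a < D → Position D a
  middle : Middle D a → Position D a
  above  : suc (suc D) ≤ a → Position D a

position : ∀ D a → Position D a
position zero    zero          = middle (inj₁ refl)
position zero    (suc zero)    = middle (inj₂ refl)
position zero    (suc (suc a)) = above (s≤s (s≤s z≤n))
position (suc D) zero          = below (s≤s z≤n)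
position (suc D) (suc a) with position D a
... | below lt = below (s≤s lt)
... | middle m = middle (middle-suc m)
... | above ge = above (s≤s ge)

band-below : ∀ D a b → a < D → band D b ≡ band D a → b ≡ a
band-below (suc D) zero    zero    _        _  = refl
band-below (suc D) (suc a) (suc b) (s≤s lt) eq =
  cong suc (band-below D a b lt (Fin.suc-injective eq))

band-middle : ∀ D a b → Middle D a → band D b ≡ band D a → Middle D b
band-middle zero    _       zero          _           _ = inj₁ refl
band-middle zero    _       (suc zero)    _           _ = inj₂ refl
band-middle zero    _       (suc (suc b)) (inj₁ refl) ()
band-middle zero    _       (suc (suc b)) (inj₂ refl) ()
band-middle (suc D) zero    _             (inj₁ ())   _
band-middle (suc D) zero    _             (inj₂ ())   _
band-middle (suc D) (suc a) zero          _           ()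
band-middle (suc D) (suc a) (suc b)       m           eq =
  middle-suc (band-middle D a b (middle-pred m) (Fin.suc-injective eq))

band-above : ∀ D a b → suc (suc D) ≤ a → band D b ≡ band D a → suc (suc D) ≤ b
band-above zero    (suc zero)    _             (s≤s ()) _
band-above zero    (suc (suc a)) zero          _        ()
band-above zero    (suc (suc a)) (suc zero)    _        ()
band-above zero    (suc (suc a)) (suc (suc b)) _        _  = s≤s (s≤s z≤n)
band-above (suc D) (suc a)       (suc b)       (s≤s le) eq =
  s≤s (band-above D a b le (Fin.suc-injective eq))

middle-cases : ∀ {n} D (s : Subset n) → Middle D (least s) → 1 ≤ ∣ s ∣ →
  (contains s D ≡ true × contains s (suc D) ≡ true)
  ⊎ bit (contains s D) + bit (contains s (suc D)) ≡ 1
middle-cases D s m ne with contains s D in inD | contains s (suc D) in inD+1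
... | true  | true  = inj₁ (refl , refl)
... | true  | false = inj₂ refl
... | false | true  = inj₂ refl
... | false | false = ⊥-elim (true≢false (trans (sym (least-contained s ne)) (absent m)))
  where
  true≢false : true ≢ false
  true≢false ()
  absent : Middle D (least s) → contains s (least s) ≡ false
  absent (inj₁ e) = trans (cong (contains s) e) inD
  absent (inj₂ e) = trans (cong (contains s) e) inD+1

-- Conflict-free witnesses in K(n,k)

ConflictFreeAt : ∀ {n k m} → (KVertex n k → Fin m) → KVertex n k → Set
ConflictFreeAt {n} {k} C v = ∃[ i ] ∃[ u ]
  ( InClosedNbhd u v × C u ≡ i
  × (∀ (w : KVertex n k) → InClosedNbhd w v → C w ≡ i → proj₁ w ≡ proj₁ u))

-- A vertex is determined by its underlying set (cardinality proofs are unique).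
vertex-≡ : ∀ {n k} {u v : KVertex n k} → proj₁ u ≡ proj₁ v → u ≡ v
vertex-≡ {u = s , p} {v = .s , q} refl = cong (s ,_) (≡-irrelevant p q)

selfWitness : ∀ {n k m} (C : KVertex n k → Fin m) (v : KVertex n k) →
              (∀ w → KAdj v w → C w ≢ C v) → ConflictFreeAt C v
selfWitness C v noRival = C v , v , inj₁ refl , refl , unique
  where
  unique : ∀ w → InClosedNbhd w v → C w ≡ C v → proj₁ w ≡ proj₁ v
  unique w (inj₁ w≡v) _    = w≡v
  unique w (inj₂ adj) same = ⊥-elim (noRival w adj same)

neighbourWitness : ∀ {n k m} (C : KVertex n k → Fin m) (v u : KVertex n k) →
  KAdj v u → C v ≢ C u → (∀ w → KAdj v w → C w ≡ C u → proj₁ w ≡ proj₁ u) →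
  ConflictFreeAt C v
neighbourWitness C v u adj differs onlyOne = C u , u , inj₂ adj , refl , unique
  where
  unique : ∀ w → InClosedNbhd w v → C w ≡ C u → proj₁ w ≡ proj₁ u
  unique w (inj₁ w≡v)  same = ⊥-elim (differs (trans (cong C (vertex-≡ (sym w≡v))) same))
  unique w (inj₂ adj′) same = onlyOne w adj′ same

-- The colouring of K(2(k+1) + (D+1), k+1) with D+2 colours

module Construction (k D : ℕ) where

  n : ℕ
  n = 2 * suc k + suc D

  Vertex : Set
  Vertex = KVertex n (suc k)

  colour : Vertex → Fin (suc (suc D))
  colour v = band D (least (proj₁ v))

  nonempty : (v : Vertex) → 1 ≤ ∣ proj₁ v ∣
  nonempty (s , size) = subst (1 ≤_) (sym size) (s≤s z≤n)

  D+2≤n : suc (suc D) ≤ n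
  D+2≤n = +-monoˡ-≤ (suc D) {1} {2 * suc k} (s≤s z≤n)

  overflow : suc k + suc k + suc (suc D) ≡ suc n
  overflow = identity k D
    where
    identity : ∀ k D → suc k + suc k + suc (suc D) ≡ suc (2 * suc k + suc D)
    identity = solve-∀

  -- Least element below D: a same-coloured neighbour has the same least element.
  below-witness : (v : Vertex) → least (proj₁ v) < D → ConflictFreeAt colour v
  below-witness v lt = selfWitness colour v noRival
    where
    noRival : ∀ w → KAdj v w → colour w ≢ colour v
    noRival w adj same = disjoint⇒least≢ (proj₁ v) (proj₁ w) adj (nonempty v) (nonempty w)
                           (sym (band-below D _ _ lt same))

  -- Least element ≥ D+2: a same-coloured neighbour would not fit beside v.
  above-witness : (v : Vertex) → suc (suc D) ≤ least (proj₁ v) → ConflictFreeAt colour v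
  above-witness v@(s , size) ge = selfWitness colour v noRival
    where
    noRival : ∀ w → KAdj v w → colour w ≢ colour v
    noRival (t , size′) adj same = 1+n≰n (begin
      suc n                          ≡⟨ overflow ⟨
      suc k + suc k + suc (suc D)    ≡⟨ sizes ⟨
      ∣ s ∣ + ∣ t ∣ + suc (suc D)    ≤⟨ disjoint-above-size (suc (suc D)) s t D+2≤n ge
                                          (band-above D _ _ ge same) adj ⟩
      n                              ∎)
      where
      open ≤-Reasoning
      sizes : ∣ s ∣ + ∣ t ∣ + suc (suc D) ≡ suc k + suc k + suc (suc D)
      sizes rewrite size | size′ = refl

  -- Least element in the middle band and both D, D+1 ∈ s: a neighbour of the
  -- same colour would have its least element in {D, D+1} ⊆ s.
  both-witness : (v : Vertex) → Middle D (least (proj₁ v)) →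
                 contains (proj₁ v) D ≡ true × contains (proj₁ v) (suc D) ≡ true →
                 ConflictFreeAt colour v
  both-witness v@(s , _) m (inD , inD+1) = selfWitness colour v noRival
    where
    inS : ∀ {a} → Middle D a → contains s a ≡ true
    inS (inj₁ refl) = inD
    inS (inj₂ refl) = inD+1
    noRival : ∀ w → KAdj v w → colour w ≢ colour v
    noRival w@(t , _) adj same =
      disjoint⇒¬shared s t (least t) adj (inS (band-middle D _ _ m same))
        (least-contained t (nonempty w))

  partner-size : (s : Subset n) → ∣ s ∣ ≡ suc k → D ≤ least s →
                 bit (contains s D) + bit (contains s (suc D)) ≡ 1 →
                 ∣ freeAbove (suc (suc D)) s ∣ ≡ suc k
  partner-size s size D≤ one =
    +-cancelˡ-≡ (suc k) _ _ (+-cancelʳ-≡ (suc (suc D)) _ _ (begin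
      suc k + ∣ freeAbove (suc (suc D)) s ∣ + suc (suc D)
        ≡⟨ cong (λ c → c + ∣ freeAbove (suc (suc D)) s ∣ + suc (suc D)) size ⟨
      ∣ s ∣ + ∣ freeAbove (suc (suc D)) s ∣ + suc (suc D)
        ≡⟨ freeAbove-size (suc (suc D)) s D+2≤n ⟩
      n + countBelow (suc (suc D)) s
        ≡⟨ cong (n +_) (trans (countBelow-window D s D≤) one) ⟩
      n + 1
        ≡⟨ n+1 k D ⟩
      suc k + suc k + suc (suc D) ∎))
    where
    open ≡-Reasoning
    n+1 : ∀ k D → 2 * suc k + suc D + 1 ≡ suc k + suc k + suc (suc D)
    n+1 = solve-∀

  -- With exactly one of D, D+1 in s, the free points above D+1 form the unique
  -- neighbour of colour D+1, while v itself has colour D.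
  partner-witness : (v : Vertex) → Middle D (least (proj₁ v)) →
                    bit (contains (proj₁ v) D) + bit (contains (proj₁ v) (suc D)) ≡ 1 →
                    ConflictFreeAt colour v
  partner-witness v@(s , size) m one =
    neighbourWitness colour v u (freeAbove-disjoint (suc (suc D)) s) differs onlyOne
    where
    u : Vertex
    u = freeAbove (suc (suc D)) s , partner-size s size (middle⇒≥ m) one
    high : suc (suc D) ≤ least (proj₁ u)
    high = freeAbove-least (suc (suc D)) s D+2≤n
    differs : colour v ≢ colour u
    differs same = middle⇒¬above m (band-above D _ _ high same)
    onlyOne : ∀ w → KAdj v w → colour w ≡ colour u → proj₁ w ≡ proj₁ u
    onlyOne (t , size′) adj same =
      freeAbove-unique (suc (suc D)) s t (band-above D _ _ high same) adj
        (≤-reflexive (trans (proj₂ u) (sym size′)))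

  conflictFree : IsCFCNColoring (suc (suc D)) colour
  conflictFree v with position D (least (proj₁ v))
  ... | below lt = below-witness v lt
  ... | above ge = above-witness v ge
  ... | middle m with middle-cases D (proj₁ v) m (nonempty v)
  ...   | inj₁ both = both-witness v m both
  ...   | inj₂ one  = partner-witness v m one

lemma10 : ∀ (k d : ℕ) → k ≥ 1 → d ≥ 1 → χCFCN-K≤ (2 * k + d) k (d + 1)
lemma10 (suc k) (suc D) _ _ =
  suc (suc D) , ≤-reflexive (+-comm 1 (suc D)) ,
  Construction.colour k D , Construction.conflictFree k D
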